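{- Let $A$ be a finite set with $\kappa=|A|$ and let $3\le h\le\kappa$. Suppose $\iota_h^A=\{(x_1,\dots,x_h)\in A^h:(\varphi(x_1),\dots,\varphi(x_h))\in\omega_\lambda\}$ for some $\lambda\ge1$ and some surjection $\varphi:A\to\{0,\dots,h-1\}^\lambda$. Then $\lambda=1$ and $h=\kappa$.
   Context: $\iota_h^A=\{(a_1,\dots,a_h)\in A^h:\exists i\neq j\ a_i=a_j\}$. With $h=\{0,\dots,h-1\}$, $\omega_\lambda$ is the $h$-ary relation on $h^\lambda$ consisting of all $(a_1,\dots,a_h)$ such that for every $1\le r\le\lambda$ the $r$-th coordinates $(a_1(r),\dots,a_h(r))$ are not pairwise distinct. -}

module Defs where

open import Data.Nat using (ℕ)
open import Data.Fin using (Fin)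
open import Data.Vec using (Vec; lookup)
open import Data.Product using (Σ; _×_; ∃; ∃-syntax)
open import Relation.Binary.PropositionalEquality using (_≡_; _≢_)

ι : (A : Set) (h : ℕ) → (Fin h → A) → Set
ι A h x = ∃[ i ] ∃[ j ] (i ≢ j × x i ≡ x j)

ω : (h λ′ : ℕ) → (Fin h → Vec (Fin h) λ′) → Set
ω h λ′ a = (r : Fin λ′) → ∃[ i ] ∃[ j ] (i ≢ j × lookup (a i) r ≡ lookup (a j) r)

Surjective : {A B : Set} → (A → B) → Set
Surjective {A} {B} f = (b : B) → ∃[ a ] (f a ≡ b)

{-# OPTIONS --safe #-}
-- Lifting along the surjection φ, every tuple in ω becomes φ ∘ x for some x in ι, so ω
-- contains no injective tuple. For λ ≥ 2 and h ≥ 3 it does contain one: (0,0,0,…), (0,1,0,…),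
-- (2,0,0,…), …, (h-1,0,0,…) repeats coordinate 0 in its first two entries and every other
-- coordinate in its first and third. Hence λ = 1, where ω (φ ∘ x) says that the values
-- φ(xᵢ) collide. If h < κ, pigeonhole yields a ≢ b with φ a ≡ φ b; completing a, b by
-- preimages of h - 2 values other than φ a gives an injective x with φ ∘ x in ω.
module Submission where

open import Defs
open import Data.Nat using (ℕ; _+_; _≤_; _<_; zero; suc; z≤n; s≤s)
open import Data.Nat.Properties using (≤∧≮⇒≡)
open import Data.Fin using (Fin; zero; suc; punchIn; inject₁)
open import Data.Fin.Properties using (pigeonhole; punchIn-injective; punchInᵢ≢i; inject₁-injective; <⇒≢)
open import Data.Vec using (Vec; lookup; _∷_; []; replicate)
open import Data.Vec.Properties using (∷-injective)
import Data.Vec.Functional as Tuple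
open import Data.Product using (_×_; _,_; proj₁; proj₂; ∃-syntax)
open import Data.Empty using (⊥-elim)
open import Function using (_∘_; _↔_; _⇔_; Inverse; Injection; Equivalence)
open import Function.Definitions using (Injective)
open import Function.Properties.Inverse using (↔-sym; ↔⇒↣)
open import Relation.Nullary using (¬_)
open import Relation.Binary.PropositionalEquality using (_≡_; refl; sym; trans; cong; _≢_)

module _ {A : Set} {h : ℕ} where

  ι-map : ∀ {B : Set} (f : A → B) {x : Fin h → A} → ι A h x → ι B h (f ∘ x)
  ι-map f (i , j , i≢j , xi≡xj) = i , j , i≢j , cong f xi≡xj

  ι-resp : ∀ {x y : Fin h → A} → (∀ i → x i ≡ y i) → ι A h x → ι A h y
  ι-resp x≗y (i , j , i≢j , xi≡xj) = i , j , i≢j , trans (sym (x≗y i)) (trans xi≡xj (x≗y j))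

  injective⇒¬ι : ∀ {x : Fin h → A} → Injective _≡_ _≡_ x → ¬ ι A h x
  injective⇒¬ι x-inj (i , j , i≢j , xi≡xj) = i≢j (x-inj xi≡xj)

ω-resp : ∀ {h λ′} {a b : Fin h → Vec (Fin h) λ′} → (∀ i → a i ≡ b i) → ω h λ′ b → ω h λ′ a
ω-resp a≗b ωb r with ωb r
... | i , j , i≢j , bij = i , j , i≢j , trans (at (a≗b i)) (trans bij (at (sym (a≗b j))))
  where
  at : ∀ {u v} → u ≡ v → lookup u r ≡ lookup v r
  at = cong (λ v → lookup v r)

ω⇒ι : ∀ {A : Set} {h λ′} (φ : A → Vec (Fin h) λ′) → Surjective φ →
      ((x : Fin h → A) → ι A h x ⇔ ω h λ′ (λ i → φ (x i))) →
      ∀ {v} → ω h λ′ v → ι (Vec (Fin h) λ′) h v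
ω⇒ι {A} {h} φ surj ι⇔ω {v} ωv =
  ι-resp φx≗v (ι-map φ (Equivalence.from (ι⇔ω x) (ω-resp φx≗v ωv)))
  where
  x : Fin h → A
  x i = proj₁ (surj (v i))
  φx≗v : ∀ i → φ (x i) ≡ v i
  φx≗v i = proj₂ (surj (v i))

module InjectiveωTuple (k m : ℕ) where

  first : Fin (3 + k) → Fin (3 + k)
  first (suc zero) = zero
  first i          = i

  second : Fin (3 + k) → Fin (3 + k)
  second (suc zero) = suc zero
  second _          = zero

  tuple : Fin (3 + k) → Vec (Fin (3 + k)) (2 + m)
  tuple i = first i ∷ second i ∷ replicate m zero

  tuple-ω : ω (3 + k) (2 + m) tuple
  tuple-ω zero          = zero , suc zero , (λ ()) , refl
  tuple-ω (suc zero)    = zero , suc (suc zero) , (λ ()) , refl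
  tuple-ω (suc (suc r)) = zero , suc zero , (λ ()) , refl

  first-second-injective : ∀ {i j} → first i ≡ first j → second i ≡ second j → i ≡ j
  first-second-injective {zero}        {zero}        _ _ = refl
  first-second-injective {suc zero}    {suc zero}    _ _ = refl
  first-second-injective {suc (suc i)} {suc (suc j)} e _ = e
  first-second-injective {zero}        {suc zero}    _ ()
  first-second-injective {suc zero}    {zero}        _ ()
  first-second-injective {zero}        {suc (suc j)} () _
  first-second-injective {suc (suc i)} {zero}        () _
  first-second-injective {suc zero}    {suc (suc j)} () _
  first-second-injective {suc (suc i)} {suc zero}    () _

  tuple-injective : Injective _≡_ _≡_ tuple
  tuple-injective e with ∷-injective e
  ... | first≡ , rest≡ = first-second-injective first≡ (proj₁ (∷-injective rest≡))

injective-∷ : ∀ {A : Set} {n} {a : A} {x : Fin n → A} →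
              Injective _≡_ _≡_ x → (∀ i → a ≢ x i) → Injective _≡_ _≡_ (a Tuple.∷ x)
injective-∷ x-inj a∉x {zero}  {zero}  _ = refl
injective-∷ x-inj a∉x {zero}  {suc j} e = ⊥-elim (a∉x j e)
injective-∷ x-inj a∉x {suc i} {zero}  e = ⊥-elim (a∉x i (sym e))
injective-∷ x-inj a∉x {suc i} {suc j} e = cong suc (x-inj e)

module CollisionTuple {A : Set} {n : ℕ} (g : A → Fin (2 + n)) (s : Fin (2 + n) → A)
                      (g∘s : ∀ c → g (s c) ≡ c) (a b : A) where

  others : Fin n → A
  others = s ∘ punchIn (g a) ∘ inject₁

  tuple : Fin (2 + n) → A
  tuple = a Tuple.∷ b Tuple.∷ others

  others-injective : Injective _≡_ _≡_ others
  others-injective e = inject₁-injective (punchIn-injective (g a) _ _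
    (trans (sym (g∘s _)) (trans (cong g e) (g∘s _))))

  ∉others : ∀ {u} → g u ≡ g a → ∀ j → u ≢ others j
  ∉others gu≡ga j u≡ = punchInᵢ≢i (g a) (inject₁ j)
    (trans (sym (g∘s _)) (trans (cong g (sym u≡)) gu≡ga))

  tuple-injective : a ≢ b → g a ≡ g b → Injective _≡_ _≡_ tuple
  tuple-injective a≢b ga≡gb = injective-∷ (injective-∷ others-injective (∉others (sym ga≡gb)))
    λ { zero → a≢b ; (suc j) → ∉others refl j }

coordinate : ∀ {A : Set} {h} → (A → Vec (Fin h) 1) → A → Fin h
coordinate φ u = lookup (φ u) zero

coordinate-≢ : ∀ {A : Set} {n} (φ : A → Vec (Fin (2 + n)) 1) → Surjective φ →
               ((x : Fin (2 + n) → A) → ι A (2 + n) x ⇔ ω (2 + n) 1 (λ i → φ (x i))) →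
               ∀ {a b} → a ≢ b → coordinate φ a ≢ coordinate φ b
coordinate-≢ {A} {n} φ surj ι⇔ω {a} {b} a≢b ca≡cb =
  injective⇒¬ι (tuple-injective a≢b ca≡cb) (Equivalence.from (ι⇔ω tuple) collision)
  where
  section : Fin (2 + n) → A
  section c = proj₁ (surj (c ∷ []))
  coordinate∘section : ∀ c → coordinate φ (section c) ≡ c
  coordinate∘section c = cong (λ v → lookup v zero) (proj₂ (surj (c ∷ [])))
  open CollisionTuple (coordinate φ) section coordinate∘section a b
  collision : ω (2 + n) 1 (λ i → φ (tuple i))
  collision zero = zero , suc zero , (λ ()) , ca≡cb

pigeonhole-↔ : ∀ {A : Set} {m κ} → A ↔ Fin κ → m < κ →
               (g : A → Fin m) → ∃[ a ] ∃[ b ] (a ≢ b × g a ≡ g b)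
pigeonhole-↔ A↔κ m<κ g =
  let i , j , i<j , gi≡gj = pigeonhole m<κ (g ∘ from)
  in  from i , from j , <⇒≢ i<j ∘ from-injective , gi≡gj
  where
  open Inverse A↔κ using (from)
  from-injective : Injective _≡_ _≡_ from
  from-injective = Injection.injective (↔⇒↣ (↔-sym A↔κ))

lemma3p26 : (A : Set) (κ : ℕ) → A ↔ Fin κ →
    (h : ℕ) → 3 ≤ h → h ≤ κ →
    (λ′ : ℕ) → 1 ≤ λ′ →
    (φ : A → Vec (Fin h) λ′) → Surjective φ →
    ((x : Fin h → A) → ι A h x ⇔ ω h λ′ (λ i → φ (x i))) →
    λ′ ≡ 1 × h ≡ κ
lemma3p26 A κ A↔κ (suc (suc (suc k))) (s≤s (s≤s (s≤s z≤n))) h≤κ (suc (suc m)) _ φ surj ι⇔ω =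
  ⊥-elim (injective⇒¬ι tuple-injective (ω⇒ι φ surj ι⇔ω tuple-ω))
  where open InjectiveωTuple k m
lemma3p26 A κ A↔κ (suc (suc (suc k))) (s≤s (s≤s (s≤s z≤n))) h≤κ 1 _ φ surj ι⇔ω = refl , ≤∧≮⇒≡ h≤κ h≮κ
  where
  h≮κ : ¬ 3 + k < κ
  h≮κ h<κ with pigeonhole-↔ A↔κ h<κ (coordinate φ)
  ... | a , b , a≢b , ca≡cb = coordinate-≢ φ surj ι⇔ω a≢b ca≡cb
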